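{- Let $A,B\in\mathbb{Z}$ with $AB\neq0$ and $k\in\{1,2\}$. If $f(x)=x^6+Ax^{2k}+B$ is monogenic, then $B$ is squarefree.
   Context: A monic polynomial $f(x)\in\mathbb{Z}[x]$ is monogenic if it is irreducible over $\mathbb{Q}$ and $\{1,\theta,\dots,\theta^{5}\}$ is a basis for the ring of integers of $\mathbb{Q}(\theta)$, where $f(\theta)=0$. -}

module Defs where

open import Data.Nat as ℕ using (ℕ; zero; suc)
open import Data.Nat.Primality using (Prime)
open import Data.Nat.Divisibility using (_∣_)
open import Data.Integer as ℤ using (ℤ; +_)
open import Data.Integer.Divisibility as ℤD using ()
open import Data.Rational as ℚ using (ℚ; 0ℚ; 1ℚ)
open import Data.Fin as Fin using (Fin; toℕ)
open import Data.Vec as Vec using (Vec; lookup; tabulate; _∷_; [])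
open import Data.List as List using (List; []; _∷_; upTo)
open import Data.Bool using (if_then_else_)
open import Data.Product using (Σ; ∃; _×_; _,_)
open import Relation.Nullary using (¬_; does)
open import Relation.Binary.PropositionalEquality using (_≡_; _≢_)
open import Function.Bundles using (_⇔_)

ιℤ : ℤ → ℚ
ιℤ z = z ℚ./ 1

sumℚ : List ℚ → ℚ
sumℚ = List.foldr ℚ._+_ 0ℚ

-- Monic polynomials of degree 6 over ℤ:  x^6 + c₅x^5 + … + c₁x + c₀,
-- represented by the vector (c₀, …, c₅) of lower coefficients.

MonicDeg6 : Set
MonicDeg6 = Vec ℤ 6

coeffℚ : MonicDeg6 → ℕ → ℚ
coeffℚ c n with n ℕ.<? 6
... | Relation.Nullary.yes p = ιℤ (lookup c (Fin.fromℕ< p))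
... | Relation.Nullary.no _ = if does (n ℕ.≟ 6) then 1ℚ else 0ℚ

vcoeff : ∀ {n} → Vec ℚ n → ℕ → ℚ
vcoeff [] _ = 0ℚ
vcoeff (a ∷ _) zero = a
vcoeff (_ ∷ v) (suc i) = vcoeff v i

mulCoeff : ∀ {m n} → Vec ℚ m → Vec ℚ n → ℕ → ℚ
mulCoeff g h i = sumℚ (List.map (λ j → vcoeff g j ℚ.* vcoeff h (i ℕ.∸ j)) (upTo (suc i)))

-- f is reducible over ℚ: f = g·h with g, h ∈ ℚ[x] of degrees m+1 ≥ 1 and
-- n+1 ≥ 1 (leading coefficients nonzero).
ReducibleOverℚ : MonicDeg6 → Set
ReducibleOverℚ c =
  Σ ℕ λ m → Σ ℕ λ n → Σ (Vec ℚ (suc (suc m))) λ g → Σ (Vec ℚ (suc (suc n))) λ h →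
    (Vec.last g ≢ 0ℚ) × (Vec.last h ≢ 0ℚ) × (∀ i → mulCoeff g h i ≡ coeffℚ c i)

IrreducibleOverℚ : MonicDeg6 → Set
IrreducibleOverℚ c = ¬ ReducibleOverℚ c

-- The field K = ℚ(θ) ≅ ℚ[x]/(f), elements written in the power basis
-- a₀ + a₁θ + … + a₅θ⁵, i.e. as vectors in ℚ⁶.

K : Set
K = Vec ℚ 6

-- multiplication by θ, using θ⁶ = -(c₀ + c₁θ + … + c₅θ⁵)
mulθ : MonicDeg6 → K → K
mulθ c a = tabulate λ i → prev i ℚ.- (ιℤ (lookup c i) ℚ.* Vec.last a)
  where
  prev : Fin 6 → ℚ
  prev Fin.zero = 0ℚ
  prev (Fin.suc j) = lookup a (Fin.inject₁ j)

addK : K → K → K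
addK = Vec.zipWith ℚ._+_

scaleK : ℚ → K → K
scaleK q = Vec.map (q ℚ.*_)

zeroK : K
zeroK = Vec.replicate 6 0ℚ

oneK : K
oneK = 1ℚ ∷ Vec.replicate 5 0ℚ

mulθ^ : MonicDeg6 → ℕ → K → K
mulθ^ c zero a = a
mulθ^ c (suc i) a = mulθ c (mulθ^ c i a)

mulK : MonicDeg6 → K → K → K
mulK c a b = List.foldr addK zeroK
  (List.map (λ i → scaleK (lookup b i) (mulθ^ c (toℕ i) a)) (List.allFin 6))

powK : MonicDeg6 → K → ℕ → K
powK c a zero = oneK
powK c a (suc n) = mulK c a (powK c a n)

evalMonic : MonicDeg6 → ∀ {n} → Vec ℤ n → K → K
evalMonic c {n} p α =
  addK (powK c α n)
       (List.foldr addK zeroK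
          (List.map (λ i → scaleK (ιℤ (lookup p i)) (powK c α (toℕ i))) (List.allFin n)))

IsAlgebraicInteger : MonicDeg6 → K → Set
IsAlgebraicInteger c α = Σ ℕ λ n → Σ (Vec ℤ n) λ p → evalMonic c p α ≡ zeroK

InPowerBasisSpan : K → Set
InPowerBasisSpan α = Σ (Vec ℤ 6) λ z → α ≡ Vec.map ιℤ z

-- f monogenic: irreducible over ℚ and {1,θ,…,θ⁵} is a ℤ-basis of the ring of
-- integers of ℚ(θ) (these are ℚ-linearly independent, so this says exactly
-- that the ring of integers equals their ℤ-span).
Monogenic : MonicDeg6 → Set
Monogenic c = IrreducibleOverℚ c × (∀ α → IsAlgebraicInteger c α ⇔ InPowerBasisSpan α)

trinomial : ℤ → ℕ → ℤ → MonicDeg6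
trinomial A k B = tabulate λ i →
  (if does (toℕ i ℕ.≟ 0) then B else + 0) ℤ.+ (if does (toℕ i ℕ.≟ 2 ℕ.* k) then A else + 0)

SquareFree : ℤ → Set
SquareFree B = ∀ p → Prime p → ¬ ((p ℕ.* p) ∣ ℤ.∣ B ∣)

{-# OPTIONS --safe #-}

-- Suppose p is prime and B = t p². The element α = (θ⁵ + A θ^(2k−1)) / p satisfies
-- α θ = (θ⁶ + A θ^(2k)) / p = −B / p, so α = −t p / θ, and substituting θ = −t p / α
-- into f shows that α is a root of the monic integer polynomial
-- y⁶ + A t^(2k−1) p^(2k−2) y^(6−2k) + t⁵ p⁴. So α is an algebraic integer, but its
-- θ⁵-coordinate 1/p is not an integer, and {1, θ, …, θ⁵} is not an integral basis.
--
-- That α is a root is checked in the power basis with A, B and q = 1/p as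
-- indeterminates: the coordinates of the minimal polynomial evaluated at α normalise to
-- zero under the ring solver, and B = t p², p q = 1 are used only to see that its
-- coefficients are integers.

module Submission where

open import Defs
open import Data.Nat using (ℕ)
open import Data.Integer using (ℤ; _*_; +_)
open import Data.Sum using (_⊎_)
open import Relation.Binary.PropositionalEquality using (_≡_; _≢_)

open import Algebra.Solver.Ring.AlmostCommutativeRing
  using (AlmostCommutativeRing; fromCommutativeRing; _-Raw-AlmostCommutative⟶_; Induced-equivalence)
open import Data.Bool using (if_then_else_)
open import Data.Fin as Fin using (Fin; toℕ)
import Data.Integer as ℤ
import Data.Integer.Divisibility.Signed as ℤ
import Data.Integer.Properties as ℤ
import Data.List as List
open import Data.Maybe using (just; nothing)
open import Data.Nat as ℕ using (zero; suc; _≡ᵇ_; _∸_)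
open import Data.Nat.Primality using (Prime; prime⇒nonZero; prime⇒nonTrivial)
import Data.Nat.Properties as ℕ
open import Data.Product using (Σ; _,_)
open import Data.Rational as ℚ using (ℚ; 0ℚ; 1ℚ)
import Data.Rational.Properties as ℚ
import Data.Rational.Unnormalised as ℚᵘ
import Data.Rational.Unnormalised.Properties as ℚᵘ
open import Data.Sum using (inj₁; inj₂)
open import Data.Vec as Vec using (Vec; []; _∷_; lookup; tabulate)
import Data.Vec.Properties as Vec
open import Function using (_∘_)
open import Function.Bundles using (Equivalence)
open import Relation.Binary.Definitions using (WeaklyDecidable)
open import Relation.Binary.PropositionalEquality using (refl; sym; trans; cong; cong₂; module ≡-Reasoning)
open import Relation.Nullary using (yes; no)

open import Algebra.Definitions.RawSemiring ℚ.+-*-rawSemiring using (_^_)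

open ≡-Reasoning

toℚᵘ-ιℤ : ∀ z → ℚ.toℚᵘ (ιℤ z) ℚᵘ.≃ ℚᵘ.mkℚᵘ z 0
toℚᵘ-ιℤ z = ℚ.toℚᵘ-fromℚᵘ (ℚᵘ.mkℚᵘ z 0)

ιℤ-homo-+ : ∀ x y → ιℤ (x ℤ.+ y) ≡ ιℤ x ℚ.+ ιℤ y
ιℤ-homo-+ x y = ℚ.toℚᵘ-injective (ℚᵘ.≃-trans (toℚᵘ-ιℤ (x ℤ.+ y)) (ℚᵘ.≃-sym
  (ℚᵘ.≃-trans (ℚ.toℚᵘ-homo-+ (ιℤ x) (ιℤ y))
  (ℚᵘ.≃-trans (ℚᵘ.+-cong (toℚᵘ-ιℤ x) (toℚᵘ-ιℤ y)) (ℚᵘ.*≡* cross-multiplied)))))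
  where
  cross-multiplied : (x ℤ.* + 1 ℤ.+ y ℤ.* + 1) ℤ.* + 1 ≡ (x ℤ.+ y) ℤ.* + 1
  cross-multiplied = cong (ℤ._* + 1) (cong₂ ℤ._+_ (ℤ.*-identityʳ x) (ℤ.*-identityʳ y))

ιℤ-homo-* : ∀ x y → ιℤ (x ℤ.* y) ≡ ιℤ x ℚ.* ιℤ y
ιℤ-homo-* x y = ℚ.toℚᵘ-injective (ℚᵘ.≃-trans (toℚᵘ-ιℤ (x ℤ.* y)) (ℚᵘ.≃-sym
  (ℚᵘ.≃-trans (ℚ.toℚᵘ-homo-* (ιℤ x) (ιℤ y)) (ℚᵘ.*-cong (toℚᵘ-ιℤ x) (toℚᵘ-ιℤ y)))))

ιℤ-homo‿- : ∀ x → ιℤ (ℤ.- x) ≡ ℚ.- ιℤ x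
ιℤ-homo‿- x = ℚ.toℚᵘ-injective (ℚᵘ.≃-trans (toℚᵘ-ιℤ (ℤ.- x)) (ℚᵘ.≃-sym
  (ℚᵘ.≃-trans (ℚ.toℚᵘ-homo‿- (ιℤ x)) (ℚᵘ.-‿cong (toℚᵘ-ιℤ x)))))

ιℤ-homo-^ : ∀ x n → ιℤ (x ℤ.^ n) ≡ ιℤ x ^ n
ιℤ-homo-^ x zero    = refl
ιℤ-homo-^ x (suc n) = trans (ιℤ-homo-* x (x ℤ.^ n)) (cong (ιℤ x ℚ.*_) (ιℤ-homo-^ x n))

ιℤ-injective : ∀ {x y} → ιℤ x ≡ ιℤ y → x ≡ y
ιℤ-injective {x} {y} ιx≡ιy
  with ℚᵘ.≃-trans (ℚᵘ.≃-sym (toℚᵘ-ιℤ x)) (ℚᵘ.≃-trans (ℚ.toℚᵘ-cong ιx≡ιy) (toℚᵘ-ιℤ y))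
... | ℚᵘ.*≡* x*1≡y*1 = trans (sym (ℤ.*-identityʳ x)) (trans x*1≡y*1 (ℤ.*-identityʳ y))

ℚ-ring : AlmostCommutativeRing _ _
ℚ-ring = fromCommutativeRing ℚ.+-*-commutativeRing

ιℤ-morphism : ℤ.+-*-rawRing -Raw-AlmostCommutative⟶ ℚ-ring
ιℤ-morphism = record
  { ⟦_⟧ = ιℤ ; +-homo = ιℤ-homo-+ ; *-homo = ιℤ-homo-* ; -‿homo = ιℤ-homo‿-
  ; 0-homo = refl ; 1-homo = refl }

_ℤ≟_ : WeaklyDecidable (Induced-equivalence ιℤ-morphism)
x ℤ≟ y with x ℤ.≟ y
... | yes refl = just refl
... | no _     = nothing

open import Algebra.Solver.Ring ℤ.+-*-rawRing ℚ-ring ιℤ-morphism _ℤ≟_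

weaken : ∀ {n} → Polynomial n → Polynomial (suc n)
weaken (op o e₁ e₂) = op o (weaken e₁) (weaken e₂)
weaken (con c)      = con c
weaken (var x)      = var (Fin.suc x)
weaken (e :^ k)     = weaken e :^ k
weaken (:- e)       = :- weaken e

weaken-correct : ∀ {n} (e : Polynomial n) x ρ → ⟦ weaken e ⟧ (x ∷ ρ) ≡ ⟦ e ⟧ ρ
weaken-correct (op o e₁ e₂) x ρ = cong₂ (sem o) (weaken-correct e₁ x ρ) (weaken-correct e₂ x ρ)
weaken-correct (con c)      x ρ = refl
weaken-correct (var i)      x ρ = refl
weaken-correct (e :^ k)     x ρ = cong (_^ k) (weaken-correct e x ρ)
weaken-correct (:- e)       x ρ = cong ℚ.-_ (weaken-correct e x ρ)

mutual
  reifyH : ∀ {n} → HNF (suc n) → Polynomial (suc n)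
  reifyH ∅         = con (+ 0)
  reifyH (h *x+ c) = reifyH h :* var Fin.zero :+ weaken (reifyN c)

  reifyN : ∀ {n} → Normal n → Polynomial n
  reifyN (con c)  = con c
  reifyN (poly h) = reifyH h

mutual
  reifyH-correct : ∀ {n} (h : HNF (suc n)) x ρ → ⟦ reifyH h ⟧ (x ∷ ρ) ≡ ⟦ h ⟧H (x ∷ ρ)
  reifyH-correct ∅         x ρ = refl
  reifyH-correct (h *x+ c) x ρ = cong₂ (λ u v → u ℚ.* x ℚ.+ v)
    (reifyH-correct h x ρ) (trans (weaken-correct (reifyN c) x ρ) (reifyN-correct c ρ))

  reifyN-correct : ∀ {n} (N : Normal n) ρ → ⟦ reifyN N ⟧ ρ ≡ ⟦ N ⟧N ρ
  reifyN-correct (con c)  ρ       = refl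
  reifyN-correct (poly h) (x ∷ ρ) = reifyH-correct h x ρ

simplify : ∀ {n} → Polynomial n → Polynomial n
simplify = reifyN ∘ normalise

simplify-correct : ∀ {n} (e : Polynomial n) ρ → ⟦ simplify e ⟧ ρ ≡ ⟦ e ⟧ ρ
simplify-correct e ρ = trans (reifyN-correct (normalise e) ρ) (correct e ρ)

Kᴾ : ℕ → Set
Kᴾ n = Vec (Polynomial n) 6

⟦_⟧ᵛ : ∀ {n m} → Vec (Polynomial n) m → Env n → Vec ℚ m
⟦ v ⟧ᵛ ρ = Vec.map (λ e → ⟦ e ⟧ ρ) v

module _ {n : ℕ} where

  mulθᴾ : Kᴾ n → Kᴾ n → Kᴾ n
  mulθᴾ c a = tabulate λ i → shifted i :- (lookup c i :* Vec.last a)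
    where
    shifted : Fin 6 → Polynomial n
    shifted Fin.zero    = con (+ 0)
    shifted (Fin.suc j) = lookup a (Fin.inject₁ j)

  addKᴾ : Kᴾ n → Kᴾ n → Kᴾ n
  addKᴾ = Vec.zipWith _:+_

  scaleKᴾ : Polynomial n → Kᴾ n → Kᴾ n
  scaleKᴾ e = Vec.map (e :*_)

  zeroKᴾ : Kᴾ n
  zeroKᴾ = Vec.replicate 6 (con (+ 0))

  oneKᴾ : Kᴾ n
  oneKᴾ = con (+ 1) ∷ Vec.replicate 5 (con (+ 0))

  mulθ^ᴾ : Kᴾ n → ℕ → Kᴾ n → Kᴾ n
  mulθ^ᴾ c zero    a = a
  mulθ^ᴾ c (suc i) a = mulθᴾ c (mulθ^ᴾ c i a)

  sumKᴾ : List.List (Kᴾ n) → Kᴾ n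
  sumKᴾ = List.foldr addKᴾ zeroKᴾ

  mulKᴾ : Kᴾ n → Kᴾ n → Kᴾ n → Kᴾ n
  mulKᴾ c a b = sumKᴾ (List.map (λ i → scaleKᴾ (lookup b i) (mulθ^ᴾ c (toℕ i) a)) (List.allFin 6))

  -- Each power is simplified before the next multiplication; otherwise the
  -- expression trees grow exponentially.
  powKᴾ : Kᴾ n → Kᴾ n → ℕ → Kᴾ n
  powKᴾ c a zero    = oneKᴾ
  powKᴾ c a (suc m) = Vec.map simplify (mulKᴾ c a (powKᴾ c a m))

  evalMonicᴾ : Kᴾ n → ∀ {m} → Vec (Polynomial n) m → Kᴾ n → Kᴾ n
  evalMonicᴾ c {m} p a = addKᴾ (powKᴾ c a m)
    (sumKᴾ (List.map (λ i → scaleKᴾ (lookup p i) (powKᴾ c a (toℕ i))) (List.allFin m)))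

module _ {n} (ρ : Env n) where

  proveᵛ : ∀ {m} (u v : Vec (Polynomial n) m) →
           Vec.map normalise u ≡ Vec.map normalise v → ⟦ u ⟧ᵛ ρ ≡ ⟦ v ⟧ᵛ ρ
  proveᵛ []      []      _  = refl
  proveᵛ (x ∷ u) (y ∷ v) eq = cong₂ _∷_
    (prove ρ x y (cong (λ N → ⟦ N ⟧N ρ) (Vec.∷-injectiveˡ eq))) (proveᵛ u v (Vec.∷-injectiveʳ eq))

  addKᴾ-homo : ∀ u v → addK (⟦ u ⟧ᵛ ρ) (⟦ v ⟧ᵛ ρ) ≡ ⟦ addKᴾ u v ⟧ᵛ ρ
  addKᴾ-homo (_ ∷ _ ∷ _ ∷ _ ∷ _ ∷ _ ∷ []) (_ ∷ _ ∷ _ ∷ _ ∷ _ ∷ _ ∷ []) = refl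

  scaleKᴾ-homo : ∀ e v → scaleK (⟦ e ⟧ ρ) (⟦ v ⟧ᵛ ρ) ≡ ⟦ scaleKᴾ e v ⟧ᵛ ρ
  scaleKᴾ-homo e v = trans (sym (Vec.map-∘ _ _ v)) (Vec.map-∘ _ _ v)

  sumKᴾ-homo : ∀ {A : Set} (g : A → K) (f : A → Kᴾ n) → (∀ x → g x ≡ ⟦ f x ⟧ᵛ ρ) →
               ∀ xs → List.foldr addK zeroK (List.map g xs) ≡ ⟦ sumKᴾ (List.map f xs) ⟧ᵛ ρ
  sumKᴾ-homo g f g≡f List.[]       = refl
  sumKᴾ-homo g f g≡f (x List.∷ xs) =
    trans (cong₂ addK (g≡f x) (sumKᴾ-homo g f g≡f xs)) (addKᴾ-homo (f x) _)

  mulθᴾ-homo : ∀ {c cᴾ} → Vec.map ιℤ c ≡ ⟦ cᴾ ⟧ᵛ ρ → ∀ a → mulθ c (⟦ a ⟧ᵛ ρ) ≡ ⟦ mulθᴾ cᴾ a ⟧ᵛ ρ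
  mulθᴾ-homo {_ ∷ _ ∷ _ ∷ _ ∷ _ ∷ _ ∷ []} {_ ∷ _ ∷ _ ∷ _ ∷ _ ∷ _ ∷ []} c≈cᴾ
             a@(_ ∷ _ ∷ _ ∷ _ ∷ _ ∷ _ ∷ []) =
    cong (Vec.zipWith (λ s r → s ℚ.- r ℚ.* Vec.last x) (0ℚ ∷ Vec.init x)) c≈cᴾ
    where x = ⟦ a ⟧ᵛ ρ

  module _ {c : MonicDeg6} {cᴾ : Kᴾ n} (c≈cᴾ : Vec.map ιℤ c ≡ ⟦ cᴾ ⟧ᵛ ρ) where

    mulθ^ᴾ-homo : ∀ i a → mulθ^ c i (⟦ a ⟧ᵛ ρ) ≡ ⟦ mulθ^ᴾ cᴾ i a ⟧ᵛ ρ
    mulθ^ᴾ-homo zero    a = refl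
    mulθ^ᴾ-homo (suc i) a = trans (cong (mulθ c) (mulθ^ᴾ-homo i a)) (mulθᴾ-homo c≈cᴾ (mulθ^ᴾ cᴾ i a))

    mulKᴾ-homo : ∀ a b → mulK c (⟦ a ⟧ᵛ ρ) (⟦ b ⟧ᵛ ρ) ≡ ⟦ mulKᴾ cᴾ a b ⟧ᵛ ρ
    mulKᴾ-homo a b = sumKᴾ-homo _ _ term-homo (List.allFin 6)
      where
      term-homo : ∀ i → scaleK (lookup (⟦ b ⟧ᵛ ρ) i) (mulθ^ c (toℕ i) (⟦ a ⟧ᵛ ρ))
                      ≡ ⟦ scaleKᴾ (lookup b i) (mulθ^ᴾ cᴾ (toℕ i) a) ⟧ᵛ ρ
      term-homo i = trans (cong₂ scaleK (Vec.lookup-map i _ b) (mulθ^ᴾ-homo (toℕ i) a)) (scaleKᴾ-homo _ _)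

    powKᴾ-homo : ∀ a m → powK c (⟦ a ⟧ᵛ ρ) m ≡ ⟦ powKᴾ cᴾ a m ⟧ᵛ ρ
    powKᴾ-homo a zero    = refl
    powKᴾ-homo a (suc m) = begin
      mulK c (⟦ a ⟧ᵛ ρ) (powK c (⟦ a ⟧ᵛ ρ) m)          ≡⟨ cong (mulK c (⟦ a ⟧ᵛ ρ)) (powKᴾ-homo a m) ⟩
      mulK c (⟦ a ⟧ᵛ ρ) (⟦ P ⟧ᵛ ρ)                      ≡⟨ mulKᴾ-homo a P ⟩
      ⟦ mulKᴾ cᴾ a P ⟧ᵛ ρ                                ≡⟨ Vec.map-cong (λ e → sym (simplify-correct e ρ)) _ ⟩
      Vec.map (λ e → ⟦ simplify e ⟧ ρ) (mulKᴾ cᴾ a P)  ≡⟨ Vec.map-∘ _ _ _ ⟩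
      ⟦ powKᴾ cᴾ a (suc m) ⟧ᵛ ρ                          ∎
      where P = powKᴾ cᴾ a m

    evalMonicᴾ-homo : ∀ a {m} (p : Vec ℤ m) pᴾ → Vec.map ιℤ p ≡ ⟦ pᴾ ⟧ᵛ ρ →
                      evalMonic c p (⟦ a ⟧ᵛ ρ) ≡ ⟦ evalMonicᴾ cᴾ pᴾ a ⟧ᵛ ρ
    evalMonicᴾ-homo a {m} p pᴾ p≈pᴾ =
      trans (cong₂ addK (powKᴾ-homo a m) (sumKᴾ-homo _ _ term-homo (List.allFin m))) (addKᴾ-homo _ _)
      where
      coefficient : ∀ i → ιℤ (lookup p i) ≡ ⟦ lookup pᴾ i ⟧ ρ
      coefficient i = trans (sym (Vec.lookup-map i ιℤ p))
                            (trans (cong (λ v → lookup v i) p≈pᴾ) (Vec.lookup-map i _ pᴾ))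
      term-homo : ∀ i → scaleK (ιℤ (lookup p i)) (powK c (⟦ a ⟧ᵛ ρ) (toℕ i))
                      ≡ ⟦ scaleKᴾ (lookup pᴾ i) (powKᴾ cᴾ a (toℕ i)) ⟧ᵛ ρ
      term-homo i = trans (cong₂ scaleK (coefficient i) (powKᴾ-homo a (toℕ i))) (scaleKᴾ-homo _ _)

annihilatedᴾ⇒isAlgebraicInteger :
  ∀ {n m} (ρ : Env n) {c : MonicDeg6} (cᴾ αᴾ : Kᴾ n) (p : Vec ℤ m) (pᴾ : Vec (Polynomial n) m) →
  Vec.map ιℤ c ≡ ⟦ cᴾ ⟧ᵛ ρ → Vec.map ιℤ p ≡ ⟦ pᴾ ⟧ᵛ ρ →
  Vec.map normalise (evalMonicᴾ cᴾ pᴾ αᴾ) ≡ Vec.map normalise zeroKᴾ →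
  IsAlgebraicInteger c (⟦ αᴾ ⟧ᵛ ρ)
annihilatedᴾ⇒isAlgebraicInteger {m = m} ρ {c} cᴾ αᴾ p pᴾ c≈cᴾ p≈pᴾ p[α]↓≡0↓ = m , p , (begin
  evalMonic c p (⟦ αᴾ ⟧ᵛ ρ)    ≡⟨ evalMonicᴾ-homo ρ c≈cᴾ αᴾ p pᴾ p≈pᴾ ⟩
  ⟦ evalMonicᴾ cᴾ pᴾ αᴾ ⟧ᵛ ρ  ≡⟨ proveᵛ ρ _ zeroKᴾ p[α]↓≡0↓ ⟩
  zeroK                        ∎)

module _ {P q : ℚ} (Pq≡1 : P ℚ.* q ≡ 1ℚ) where

  [TP²]^[1+j]*q^[2+j]≡T^[1+j]*P^j : ∀ T j → (T ℚ.* (P ℚ.* P)) ^ suc j ℚ.* q ^ suc (suc j) ≡ T ^ suc j ℚ.* P ^ j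
  [TP²]^[1+j]*q^[2+j]≡T^[1+j]*P^j T zero = begin
    T ℚ.* (P ℚ.* P) ℚ.* 1ℚ ℚ.* (q ℚ.* (q ℚ.* 1ℚ))
      ≡⟨ solve 3 (λ T P q → T :* (P :* P) :* con (+ 1) :* (q :* (q :* con (+ 1)))
                           := T :* con (+ 1) :* con (+ 1) :* ((P :* q) :* (P :* q))) refl T P q ⟩
    T ℚ.* 1ℚ ℚ.* 1ℚ ℚ.* ((P ℚ.* q) ℚ.* (P ℚ.* q))
      ≡⟨ cong (λ u → T ℚ.* 1ℚ ℚ.* 1ℚ ℚ.* (u ℚ.* u)) Pq≡1 ⟩
    T ℚ.* 1ℚ ℚ.* 1ℚ ℚ.* 1ℚ
      ≡⟨ ℚ.*-identityʳ _ ⟩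
    T ℚ.* 1ℚ ℚ.* 1ℚ ∎
  [TP²]^[1+j]*q^[2+j]≡T^[1+j]*P^j T (suc j) = begin
    b ℚ.* b ^ suc j ℚ.* (q ℚ.* q ^ suc (suc j))
      ≡⟨ solve 5 (λ T P q u v → T :* (P :* P) :* u :* (q :* v) := T :* P :* (P :* q) :* (u :* v))
               refl T P q (b ^ suc j) (q ^ suc (suc j)) ⟩
    T ℚ.* P ℚ.* (P ℚ.* q) ℚ.* (b ^ suc j ℚ.* q ^ suc (suc j))
      ≡⟨ cong₂ (λ u v → T ℚ.* P ℚ.* u ℚ.* v) Pq≡1 ([TP²]^[1+j]*q^[2+j]≡T^[1+j]*P^j T j) ⟩
    T ℚ.* P ℚ.* 1ℚ ℚ.* (T ^ suc j ℚ.* P ^ j)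
      ≡⟨ solve 4 (λ T P u v → T :* P :* con (+ 1) :* (u :* v) := T :* u :* (P :* v))
               refl T P (T ^ suc j) (P ^ j) ⟩
    T ℚ.* T ^ suc j ℚ.* (P ℚ.* P ^ j) ∎
    where b = T ℚ.* (P ℚ.* P)

Aᴾ Bᴾ qᴾ : Polynomial 3
Aᴾ = var Fin.zero
Bᴾ = var (Fin.suc Fin.zero)
qᴾ = var (Fin.suc (Fin.suc Fin.zero))

trinomialᴾ : ℕ → Kᴾ 3
trinomialᴾ k = tabulate λ i →
  if toℕ i ≡ᵇ 0 then Bᴾ else if toℕ i ≡ᵇ 2 ℕ.* k then Aᴾ else con (+ 0)

reciprocalRoot : ℤ → ℕ → ℚ → K
reciprocalRoot A k q = tabulate λ i →
  if toℕ i ≡ᵇ 5 then q else if toℕ i ≡ᵇ 2 ℕ.* k ∸ 1 then ιℤ A ℚ.* q else 0ℚ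

reciprocalRootᴾ : ℕ → Kᴾ 3
reciprocalRootᴾ k = tabulate λ i →
  if toℕ i ≡ᵇ 5 then qᴾ else if toℕ i ≡ᵇ 2 ℕ.* k ∸ 1 then Aᴾ :* qᴾ else con (+ 0)

-- y⁶ + A t^(2k−1) P^(2k−2) y^(6−2k) + t⁵ P⁴ = y⁶ f(−tP/y) / B when B = t P²
-- (lower coefficients)
reciprocalMinpoly : ℤ → ℕ → ℤ → ℤ → Vec ℤ 6
reciprocalMinpoly A k t P = tabulate λ i →
  if toℕ i ≡ᵇ 0 then t ℤ.^ 5 ℤ.* P ℤ.^ 4
  else if toℕ i ≡ᵇ 6 ∸ 2 ℕ.* k then A ℤ.* (t ℤ.^ (2 ℕ.* k ∸ 1) ℤ.* P ℤ.^ (2 ℕ.* k ∸ 2))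
  else + 0

-- the same polynomial with t = B q² and P = 1/q
reciprocalMinpolyᴾ : ℕ → Kᴾ 3
reciprocalMinpolyᴾ k = tabulate λ i →
  if toℕ i ≡ᵇ 0 then Bᴾ :^ 5 :* qᴾ :^ 6
  else if toℕ i ≡ᵇ 6 ∸ 2 ℕ.* k then Aᴾ :* (Bᴾ :^ (2 ℕ.* k ∸ 1) :* qᴾ :^ (2 ℕ.* k))
  else con (+ 0)

module ReciprocalRoot {A B t P : ℤ} {q : ℚ} (B≡tP² : B ≡ t ℤ.* (P ℤ.* P)) (Pq≡1 : ιℤ P ℚ.* q ≡ 1ℚ) where

  ρ : Env 3
  ρ = ιℤ A ∷ ιℤ B ∷ q ∷ []

  A-coefficient : ιℤ (+ 0 ℤ.+ A) ≡ ιℤ A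
  A-coefficient = cong ιℤ (ℤ.+-identityˡ A)

  B-coefficient : ιℤ (B ℤ.+ + 0) ≡ ιℤ B
  B-coefficient = cong ιℤ (ℤ.+-identityʳ B)

  minpoly-coefficient : ∀ j → ιℤ (t ℤ.^ suc j ℤ.* P ℤ.^ j) ≡ ιℤ B ^ suc j ℚ.* q ^ suc (suc j)
  minpoly-coefficient j = begin
    ιℤ (t ℤ.^ suc j ℤ.* P ℤ.^ j)
      ≡⟨ trans (ιℤ-homo-* (t ℤ.^ suc j) (P ℤ.^ j)) (cong₂ ℚ._*_ (ιℤ-homo-^ t (suc j)) (ιℤ-homo-^ P j)) ⟩
    ιℤ t ^ suc j ℚ.* ιℤ P ^ j
      ≡⟨ [TP²]^[1+j]*q^[2+j]≡T^[1+j]*P^j Pq≡1 (ιℤ t) j ⟨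
    (ιℤ t ℚ.* (ιℤ P ℚ.* ιℤ P)) ^ suc j ℚ.* q ^ suc (suc j)
      ≡⟨ cong (λ b → b ^ suc j ℚ.* q ^ suc (suc j)) ιB≡tP² ⟨
    ιℤ B ^ suc j ℚ.* q ^ suc (suc j) ∎
    where
    ιB≡tP² : ιℤ B ≡ ιℤ t ℚ.* (ιℤ P ℚ.* ιℤ P)
    ιB≡tP² = trans (cong ιℤ B≡tP²) (trans (ιℤ-homo-* t _) (cong (ιℤ t ℚ.*_) (ιℤ-homo-* P P)))

  A-minpoly-coefficient : ∀ j → ιℤ (A ℤ.* (t ℤ.^ suc j ℤ.* P ℤ.^ j))
                                ≡ ιℤ A ℚ.* (ιℤ B ^ suc j ℚ.* q ^ suc (suc j))
  A-minpoly-coefficient j = trans (ιℤ-homo-* A _) (cong (ιℤ A ℚ.*_) (minpoly-coefficient j))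

  reciprocalRoot-integral : ∀ {k} → k ≡ 1 ⊎ k ≡ 2 → IsAlgebraicInteger (trinomial A k B) (reciprocalRoot A k q)
  reciprocalRoot-integral (inj₁ refl) =
    annihilatedᴾ⇒isAlgebraicInteger ρ (trinomialᴾ 1) (reciprocalRootᴾ 1)
      (reciprocalMinpoly A 1 t P) (reciprocalMinpolyᴾ 1)
      (cong₂ (λ b a → b ∷ 0ℚ ∷ a ∷ 0ℚ ∷ 0ℚ ∷ 0ℚ ∷ []) B-coefficient A-coefficient)
      (cong₂ (λ c₀ c₄ → c₀ ∷ 0ℚ ∷ 0ℚ ∷ 0ℚ ∷ c₄ ∷ 0ℚ ∷ []) (minpoly-coefficient 4) (A-minpoly-coefficient 0))
      refl
  reciprocalRoot-integral (inj₂ refl) =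
    annihilatedᴾ⇒isAlgebraicInteger ρ (trinomialᴾ 2) (reciprocalRootᴾ 2)
      (reciprocalMinpoly A 2 t P) (reciprocalMinpolyᴾ 2)
      (cong₂ (λ b a → b ∷ 0ℚ ∷ 0ℚ ∷ 0ℚ ∷ a ∷ 0ℚ ∷ []) B-coefficient A-coefficient)
      (cong₂ (λ c₀ c₂ → c₀ ∷ 0ℚ ∷ c₂ ∷ 0ℚ ∷ 0ℚ ∷ 0ℚ ∷ []) (minpoly-coefficient 4) (A-minpoly-coefficient 2))
      refl

InPowerBasisSpan⇒coordinate-integral : ∀ {α} i → InPowerBasisSpan α → Σ ℤ λ z → lookup α i ≡ ιℤ z
InPowerBasisSpan⇒coordinate-integral i (z , α≡z) =
  lookup z i , trans (cong (λ v → lookup v i) α≡z) (Vec.lookup-map i ιℤ z)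

inverse-integral⇒≡1 : ∀ {m q} → ιℤ (+ m) ℚ.* q ≡ 1ℚ → Σ ℤ (λ z → q ≡ ιℤ z) → m ≡ 1
inverse-integral⇒≡1 {m} {q} mq≡1 (z , q≡z) =
  ℕ.m*n≡1⇒m≡1 m ℤ.∣ z ∣ (trans (sym (ℤ.abs-* (+ m) z)) (cong ℤ.∣_∣ mz≡1))
  where
  mz≡1 : + m ℤ.* z ≡ + 1
  mz≡1 = ιℤ-injective (trans (ιℤ-homo-* (+ m) z) (trans (cong (ιℤ (+ m) ℚ.*_) (sym q≡z)) mq≡1))

ιℤ-nonZero : ∀ {m} → m ≢ 0 → ιℤ (+ m) ≢ 0ℚ
ιℤ-nonZero m≢0 ιm≡0 = m≢0 (ℤ.+-injective (ιℤ-injective ιm≡0))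

corollary2p9 : (A B : ℤ) (k : ℕ) → A * B ≢ + 0 → (k ≡ 1 ⊎ k ≡ 2) →
    Monogenic (trinomial A k B) → SquareFree B
corollary2p9 A B k _ k∈ (_ , integral⇔span) p p-prime p²∣∣B∣ =
  ℕ.nonTrivial⇒≢1 {{prime⇒nonTrivial p-prime}} (inverse-integral⇒≡1 pq≡1 q-integral)
  where
  open ℤ._∣_ (ℤ.∣ᵤ⇒∣ {+ (p ℕ.* p)} {B} p²∣∣B∣) renaming (quotient to t; equality to B≡t*p²)
  instance
    p-nonZero : ℚ.NonZero (ιℤ (+ p))
    p-nonZero = ℚ.≢-nonZero (ιℤ-nonZero (ℕ.≢-nonZero⁻¹ p {{prime⇒nonZero p-prime}}))
  q : ℚ
  q = ℚ.1/ ιℤ (+ p)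
  pq≡1 : ιℤ (+ p) ℚ.* q ≡ 1ℚ
  pq≡1 = ℚ.*-inverseʳ (ιℤ (+ p))
  α-integral : IsAlgebraicInteger (trinomial A k B) (reciprocalRoot A k q)
  α-integral = ReciprocalRoot.reciprocalRoot-integral {A} {B} {t} {+ p} (trans B≡t*p² (cong (t ℤ.*_) (ℤ.pos-* p p))) pq≡1 k∈
  q-integral : Σ ℤ λ z → q ≡ ιℤ z
  q-integral = InPowerBasisSpan⇒coordinate-integral (Fin.fromℕ 5) (Equivalence.to (integral⇔span _) α-integral)
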